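{- Let $m\geq 3$ be an integer and let $G$ be any $m$-dimensional restricted hypercube-like graph, i.e. $G\in RHL_m$. Then $fmp(G)=m$.
   Context: For disjoint graphs $G_0,G_1$ of the same order and a bijection $\phi:V(G_0)\to V(G_1)$, $G_0\oplus_\phi G_1$ is the graph with vertex set $V(G_0)\cup V(G_1)$ and edge set $E(G_0)\cup E(G_1)\cup\{v\phi(v): v\in V(G_0)\}$. $G(8,4)$ is the graph with vertex set $\{v_0,\dots,v_7\}$ and edges $v_iv_j$ whenever $j\equiv i+1$ or $j\equiv i+4 \pmod 8$. The restricted hypercube-like graphs are defined by $RHL_3=\{G(8,4)\}$ (up to isomorphism) and, for $m\geq 4$, $RHL_m=\{G_0\oplus_\phi G_1 : G_0,G_1\in RHL_{m-1},\ \phi \text{ a bijection } V(G_0)\to V(G_1)\}$. A fractional perfect matching of a graph $H$ is a function $f:E(H)\to[0,1]$ with $\sum_{e\ni v}f(e)=1$ for every vertex $v$. A set $F$ of edges of $H$ is a fractional matching preclusion set if $H-F$ has no fractional perfect matching; $fmp(H)$ is the minimum size of such a set.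
   Formalization: Fractional perfect matchings take values in the rationals between 0 and 1 rather than in the real interval [0,1]. -}

module Defs where

open import Data.Bool using (Bool; true; false; _∧_; _∨_; not)
open import Data.Nat as ℕ using (ℕ; suc; _≡ᵇ_; _<ᵇ_; _∸_)
open import Data.Nat.DivMod using (_%_)
open import Data.Fin using (Fin; toℕ; splitAt; _≟_)
open import Data.List using (List; allFin; map; concatMap; filterᵇ; length; foldr)
open import Data.Product using (_×_; _,_; Σ; ∃; ∃-syntax)
open import Data.Sum using (_⊎_; inj₁; inj₂)
open import Data.Rational using (ℚ; 0ℚ; 1ℚ; _+_; _≤_)
open import Function.Bundles using (_↔_; Inverse)
open import Relation.Nullary using (¬_)
open import Relation.Nullary.Decidable using (⌊_⌋)
open import Relation.Binary.PropositionalEquality using (_≡_)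

-- All graphs built below (G(8,4), ⊕-sums and
-- isomorphic copies) have symmetric, irreflexive adjacency; the edge
-- {i,j} is present iff adj i j ≡ true.
Graph : ℕ → Set
Graph n = Fin n → Fin n → Bool

-- G(8,4): v_i v_j is an edge iff j ≡ i±1 or j ≡ i+4 (mod 8).
G84 : Graph 8
G84 i j = (d ≡ᵇ 1) ∨ (d ≡ᵇ 4) ∨ (d ≡ᵇ 7)
  where
  d : ℕ
  d = (toℕ j ℕ.+ 8 ∸ toℕ i) % 8

_==_ : ∀ {n} → Fin n → Fin n → Bool
i == j = ⌊ i ≟ j ⌋

_⊕[_]_ : ∀ {n} → Graph n → (Fin n ↔ Fin n) → Graph n → Graph (n ℕ.+ n)
_⊕[_]_ {n} G0 φ G1 u v with splitAt n u | splitAt n v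
... | inj₁ i | inj₁ j = G0 i j
... | inj₂ i | inj₂ j = G1 i j
... | inj₁ i | inj₂ j = Inverse.to φ i == j
... | inj₂ j | inj₁ i = Inverse.to φ i == j

_≅_ : ∀ {n} → Graph n → Graph n → Set
_≅_ {n} G H = Σ (Fin n ↔ Fin n) λ σ →
  ∀ i j → H (Inverse.to σ i) (Inverse.to σ j) ≡ G i j

data RHL : ℕ → ∀ {n} → Graph n → Set where
  base : RHL 3 G84
  step : ∀ {m n} {G0 G1 : Graph n} → RHL m G0 → RHL m G1 →
         (φ : Fin n ↔ Fin n) → RHL (suc m) (G0 ⊕[ φ ] G1)
  iso  : ∀ {m n} {G H : Graph n} → RHL m G → G ≅ H → RHL m H

-- Edge sets to delete: F marks the pair {i,j} as deleted if F i j or F j i.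
EdgeSel : ℕ → Set
EdgeSel n = Fin n → Fin n → Bool

deleted : ∀ {n} → EdgeSel n → Fin n → Fin n → Bool
deleted F i j = F i j ∨ F j i

_-E_ : ∀ {n} → Graph n → EdgeSel n → Graph n
(G -E F) i j = G i j ∧ not (deleted F i j)

allPairs : (n : ℕ) → List (Fin n × Fin n)
allPairs n = concatMap (λ i → map (λ j → (i , j)) (allFin n)) (allFin n)

size : ∀ {n} → Graph n → EdgeSel n → ℕ
size {n} G F = length (filterᵇ (λ p → sel (Data.Product.proj₁ p) (Data.Product.proj₂ p)) (allPairs n))
  where
  sel : Fin n → Fin n → Bool
  sel i j = (toℕ i <ᵇ toℕ j) ∧ G i j ∧ deleted F i j

sumℚ : List ℚ → ℚ
sumℚ = foldr _+_ 0ℚ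

record FracPerfectMatching {n} (G : Graph n) : Set where
  field
    f      : Fin n → Fin n → ℚ
    symm   : ∀ i j → f i j ≡ f j i
    nonneg : ∀ i j → 0ℚ ≤ f i j
    le1    : ∀ i j → f i j ≤ 1ℚ
    onEdge : ∀ i j → G i j ≡ false → f i j ≡ 0ℚ
    total  : ∀ i → sumℚ (map (f i) (allFin n)) ≡ 1ℚ

FmpEq : ∀ {n} → Graph n → ℕ → Set
FmpEq {n} G k =
  (Σ (EdgeSel n) λ F → size G F ≡ k × ¬ FracPerfectMatching (G -E F))
  × (∀ (F : EdgeSel n) → size G F ℕ.< k → FracPerfectMatching (G -E F))

-- Every graph in RHL_m carries a proper m-edge-colouring whose colour
-- classes are perfect matchings: G(8,4) has one with three colours, and in
-- G₀ ⊕_φ G₁ the φ-edges form a new colour class next to the classes of G₀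
-- and G₁.  Deleting the m edges at one vertex isolates it, so fmp ≤ m.
-- Conversely, a set of fewer than m edges misses one colour class entirely,
-- and that perfect matching survives as a fractional perfect matching.
module Submission where

open import Defs
open import Data.Bool as Bool using (Bool; true; false; T; not; _∧_; _∨_; if_then_else_)
open import Data.Bool.Properties using (∨-comm; ∧-zeroʳ; ¬-not; T-≡; T-∧)
open import Data.Empty using (⊥-elim)
open import Data.Fin using (Fin; zero; suc; toℕ; _≟_; _↑ˡ_; _↑ʳ_; splitAt; join; #_)
open import Data.Fin.Properties
  using (suc-injective; toℕ-injective; injective⇒≤; any?; all?; ¬∀⟶∃¬; splitAt-↑ˡ; splitAt-↑ʳ; join-splitAt; ↑ˡ-injective; ↑ʳ-injective)
open import Data.List using (List; []; _∷_; map; allFin; tabulate; length; lookup; filterᵇ; concatMap; cartesianProduct; _++_)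
open import Data.List.Properties using (map-tabulate)
open import Data.List.Membership.Propositional using (_∈_)
open import Data.List.Membership.Propositional.Properties using (∈-filter⁺; ∈-filter⁻; ∈-lookup; ∈-allFin; ∈-cartesianProduct⁺)
import Data.List.Relation.Unary.All as All
open import Data.List.Relation.Unary.AllPairs using (_∷_)
open import Data.List.Relation.Unary.Any using (index)
open import Data.List.Relation.Unary.Any.Properties using (lookup-index)
open import Data.List.Relation.Unary.Unique.Propositional using (Unique)
import Data.List.Relation.Unary.Unique.Propositional.Properties as Unique
open import Data.Nat as ℕ using (ℕ; suc; _<ᵇ_; _≤_; _<_)
import Data.Nat.Properties as ℕ
open import Data.Product using (_×_; _,_; ∃-syntax; proj₁; proj₂)
open import Data.Rational as ℚ using (ℚ; 0ℚ; 1ℚ)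
import Data.Rational.Properties as ℚ
open import Data.Sum using (_⊎_; inj₁; inj₂)
open import Data.Vec as Vec using (Vec; []; _∷_)
open import Function using (_∘_; id)
open import Function.Bundles using (_↔_; Inverse; Equivalence)
open import Function.Definitions using (Injective)
open import Relation.Binary.Definitions using (Tri; tri<; tri≈; tri>)
open import Relation.Binary.PropositionalEquality
open import Relation.Nullary using (¬_; yes; no)
open import Relation.Nullary.Decidable using (dec-false; from-yes; T?; ¬?; _→-dec_)

==-refl : ∀ {n} (a : Fin n) → a == a ≡ true
==-refl a with a ≟ a
... | yes _   = refl
... | no a≢a = ⊥-elim (a≢a refl)

==-≢ : ∀ {n} {a b : Fin n} → a ≢ b → a == b ≡ false
==-≢ {a = a} {b} a≢b with a ≟ b
... | yes a≡b = ⊥-elim (a≢b a≡b)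
... | no _    = refl

==⇒≡ : ∀ {n} {a b : Fin n} → a == b ≡ true → a ≡ b
==⇒≡ {a = a} {b} e with a ≟ b
... | yes a≡b = a≡b
==⇒≡ () | no _

sumℚ-allFin : ∀ n (h : Fin n → ℚ) → sumℚ (map h (allFin n)) ≡ sumℚ (tabulate h)
sumℚ-allFin n h = cong sumℚ (map-tabulate id h)

sumℚ-tabulate-zero : ∀ n (h : Fin n → ℚ) → (∀ j → h j ≡ 0ℚ) → sumℚ (tabulate h) ≡ 0ℚ
sumℚ-tabulate-zero ℕ.zero h h≡0 = refl
sumℚ-tabulate-zero (suc n) h h≡0
  rewrite h≡0 zero | sumℚ-tabulate-zero n (h ∘ suc) (h≡0 ∘ suc) = refl

sumℚ-tabulate-point : ∀ n (a : Fin n) (h : Fin n → ℚ) →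
                      h a ≡ 1ℚ → (∀ j → a ≢ j → h j ≡ 0ℚ) → sumℚ (tabulate h) ≡ 1ℚ
sumℚ-tabulate-point (suc n) zero h ha≡1 h≡0
  rewrite ha≡1 | sumℚ-tabulate-zero n (h ∘ suc) (λ j → h≡0 (suc j) λ ()) = refl
sumℚ-tabulate-point (suc n) (suc a) h ha≡1 h≡0
  rewrite h≡0 zero (λ ()) | sumℚ-tabulate-point n a (h ∘ suc) ha≡1 (λ j a≢j → h≡0 (suc j) (a≢j ∘ suc-injective)) = refl

-- Fractional perfect matchings

0≤1 : 0ℚ ℚ.≤ 1ℚ
0≤1 = from-yes (0ℚ ℚ.≤? 1ℚ)

δ : ∀ {n} → Fin n → Fin n → ℚ
δ a j = if a == j then 1ℚ else 0ℚ

δ-bounds : ∀ {n} (a j : Fin n) → (0ℚ ℚ.≤ δ a j) × (δ a j ℚ.≤ 1ℚ)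
δ-bounds a j with a == j
... | true  = 0≤1 , ℚ.≤-refl
... | false = ℚ.≤-refl , 0≤1

involution⇒fpm : ∀ {n} (H : Graph n) (ν : Fin n → Fin n) →
                 (∀ i → ν (ν i) ≡ i) → (∀ i → H i (ν i) ≡ true) → FracPerfectMatching H
involution⇒fpm {n} H ν ν-involutive ν⊆H = record
  { f      = f
  ; symm   = symm
  ; nonneg = λ i j → proj₁ (δ-bounds (ν i) j)
  ; le1    = λ i j → proj₂ (δ-bounds (ν i) j)
  ; onEdge = onEdge
  ; total  = total
  }
  where
  f : Fin n → Fin n → ℚ
  f i = δ (ν i)

  symm : ∀ i j → f i j ≡ f j i
  symm i j with ν i ≟ j | ν j ≟ i
  ... | yes _    | yes _   = refl
  ... | no _     | no _    = refl
  ... | yes refl | no ¬p   = ⊥-elim (¬p (ν-involutive i))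
  ... | no ¬p    | yes refl = ⊥-elim (¬p (ν-involutive j))

  onEdge : ∀ i j → H i j ≡ false → f i j ≡ 0ℚ
  onEdge i j Hij≡false with ν i ≟ j
  ... | no _ = refl
  ... | yes refl with trans (sym Hij≡false) (ν⊆H i)
  ... | ()

  total : ∀ i → sumℚ (map (f i) (allFin n)) ≡ 1ℚ
  total i = trans (sumℚ-allFin n (f i))
    (sumℚ-tabulate-point n (ν i) (f i) (cong (if_then 1ℚ else 0ℚ) (==-refl (ν i)))
      (λ j νi≢j → cong (if_then 1ℚ else 0ℚ) (==-≢ νi≢j)))

isolated⇒¬fpm : ∀ {n} (H : Graph n) (v : Fin n) → (∀ j → H v j ≡ false) → ¬ FracPerfectMatching H
isolated⇒¬fpm {n} H v isolated fpm
  with trans (sym (total v))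
             (trans (sumℚ-allFin n (f v)) (sumℚ-tabulate-zero n (f v) (λ j → onEdge v j (isolated j))))
  where open FracPerfectMatching fpm
... | ()

injection⇒≤length : ∀ {A : Set} {m} (xs : List A) (g : Fin m → A) →
                    Injective _≡_ _≡_ g → (∀ k → g k ∈ xs) → m ≤ length xs
injection⇒≤length xs g g-injective g∈xs = injective⇒≤ λ {k} {l} same-index →
  g-injective (begin
    g k                          ≡⟨ lookup-index (g∈xs k) ⟩
    lookup xs (index (g∈xs k))   ≡⟨ cong (lookup xs) same-index ⟩
    lookup xs (index (g∈xs l))   ≡⟨ lookup-index (g∈xs l) ⟨
    g l                          ∎)
  where open ≡-Reasoning

Unique⇒lookup-injective : ∀ {A : Set} {xs : List A} → Unique xs → Injective _≡_ _≡_ (lookup xs)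
Unique⇒lookup-injective {xs = _ ∷ _}  (_ ∷ _)  {zero}  {zero}  _ = refl
Unique⇒lookup-injective {xs = _ ∷ ys} (x∉ ∷ _) {zero}  {suc j} e = ⊥-elim (All.lookup x∉ (∈-lookup {xs = ys} j) e)
Unique⇒lookup-injective {xs = _ ∷ ys} (x∉ ∷ _) {suc i} {zero}  e = ⊥-elim (All.lookup x∉ (∈-lookup {xs = ys} i) (sym e))
Unique⇒lookup-injective {xs = _ ∷ _}  (_ ∷ u)  {suc i} {suc j} e = cong suc (Unique⇒lookup-injective u e)

covered⇒length≤ : ∀ {A : Set} {m} (xs : List A) → Unique xs → (g : Fin m → A) →
                  (∀ i → ∃[ k ] lookup xs i ≡ g k) → length xs ≤ m
covered⇒length≤ xs xs-unique g covered = injective⇒≤ λ {i} {j} same-colour →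
  Unique⇒lookup-injective xs-unique
    (trans (proj₂ (covered i)) (trans (cong g same-colour) (sym (proj₂ (covered j)))))

allPairs≡cartesianProduct : ∀ n → allPairs n ≡ cartesianProduct (allFin n) (allFin n)
allPairs≡cartesianProduct n = go (allFin n)
  where
  go : (xs : List (Fin n)) → concatMap (λ i → map (i ,_) (allFin n)) xs ≡ cartesianProduct xs (allFin n)
  go []       = refl
  go (x ∷ xs) = cong (map (x ,_) (allFin n) ++_) (go xs)

allPairs-unique : ∀ n → Unique (allPairs n)
allPairs-unique n = subst Unique (sym (allPairs≡cartesianProduct n))
  (Unique.cartesianProduct⁺ (Unique.allFin⁺ n) (Unique.allFin⁺ n))

∈-allPairs : ∀ {n} (p : Fin n × Fin n) → p ∈ allPairs n
∈-allPairs {n} (i , j) = subst ((i , j) ∈_) (sym (allPairs≡cartesianProduct n))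
  (∈-cartesianProduct⁺ (∈-allFin i) (∈-allFin j))

selected : ∀ {n} → Graph n → EdgeSel n → Fin n × Fin n → Bool
selected G F (i , j) = (toℕ i <ᵇ toℕ j) ∧ G i j ∧ deleted F i j

deletedEdges : ∀ {n} → Graph n → EdgeSel n → List (Fin n × Fin n)
deletedEdges {n} G F = filterᵇ (selected G F) (allPairs n)

deletedEdges-unique : ∀ {n} (G : Graph n) (F : EdgeSel n) → Unique (deletedEdges G F)
deletedEdges-unique {n} G F = Unique.filter⁺ (T? ∘ selected G F) (allPairs-unique n)

∈-deletedEdges⁻ : ∀ {n} (G : Graph n) (F : EdgeSel n) {a b : Fin n} → (a , b) ∈ deletedEdges G F →
                  T (toℕ a <ᵇ toℕ b) × G a b ≡ true × deleted F a b ≡ true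
∈-deletedEdges⁻ {n} G F ab∈ with Equivalence.to T-∧ (proj₂ (∈-filter⁻ (T? ∘ selected G F) {xs = allPairs n} ab∈))
... | a<b , rest with Equivalence.to T-∧ rest
... | Gab , Fab = a<b , Equivalence.to T-≡ Gab , Equivalence.to T-≡ Fab

orient : ∀ {n} → Fin n → Fin n → Fin n × Fin n
orient a b = if toℕ a <ᵇ toℕ b then (a , b) else (b , a)

orient-injective : ∀ {n} {a b c d : Fin n} → orient a b ≡ orient c d → (a ≡ c × b ≡ d) ⊎ (a ≡ d × b ≡ c)
orient-injective {a = a} {b} {c} {d} e with toℕ a <ᵇ toℕ b | toℕ c <ᵇ toℕ d
orient-injective refl | true  | true  = inj₁ (refl , refl)
orient-injective refl | true  | false = inj₂ (refl , refl)
orient-injective refl | false | true  = inj₂ (refl , refl)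
orient-injective refl | false | false = inj₁ (refl , refl)

<ᵇ-asym : ∀ {x y} → T (x <ᵇ y) → (y <ᵇ x) ≡ false
<ᵇ-asym {x} {y} x<y = dec-false (T? (y <ᵇ x)) λ y<x → ℕ.<-asym (ℕ.<ᵇ⇒< x y x<y) (ℕ.<ᵇ⇒< y x y<x)

orient-< : ∀ {n} {a b : Fin n} → T (toℕ a <ᵇ toℕ b) → orient a b ≡ (a , b) × orient b a ≡ (a , b)
orient-< {a = a} {b} a<b rewrite <ᵇ-asym {toℕ a} {toℕ b} a<b | Equivalence.to T-≡ a<b = refl , refl

orient-selected : ∀ {n} (G : Graph n) (F : EdgeSel n) {a b : Fin n} → a ≢ b →
                  G a b ≡ true → G b a ≡ true → deleted F a b ≡ true → orient a b ∈ deletedEdges G F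
orient-selected {n} G F {a} {b} a≢b Gab Gba Fab =
  ∈-filter⁺ (T? ∘ selected G F) (∈-allPairs (orient a b)) (orient-selected′ (ℕ.<-cmp (toℕ a) (toℕ b)))
  where
  all-true : ∀ {x y z} → x ≡ true → y ≡ true → z ≡ true → T (x ∧ y ∧ z)
  all-true refl refl refl = _

  orient-selected′ : Tri (toℕ a < toℕ b) (toℕ a ≡ toℕ b) (toℕ b < toℕ a) → T (selected G F (orient a b))
  orient-selected′ (tri< a<b _ _) rewrite proj₁ (orient-< {a = a} {b} (ℕ.<⇒<ᵇ a<b)) =
    all-true (Equivalence.to T-≡ (ℕ.<⇒<ᵇ a<b)) Gab Fab
  orient-selected′ (tri≈ _ a≡b _) = ⊥-elim (a≢b (toℕ-injective a≡b))
  orient-selected′ (tri> _ _ b<a) rewrite proj₂ (orient-< {a = b} {a} (ℕ.<⇒<ᵇ b<a)) =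
    all-true (Equivalence.to T-≡ (ℕ.<⇒<ᵇ b<a)) Gba (trans (∨-comm (F b a) (F a b)) Fab)

star : ∀ {n} → Fin n → EdgeSel n
star v i j = i == v

star-isolates : ∀ {n} (G : Graph n) (v j : Fin n) → (G -E star v) v j ≡ false
star-isolates G v j rewrite ==-refl v = ∧-zeroʳ (G v j)

deleted-star : ∀ {n} (v : Fin n) {a b : Fin n} → deleted (star v) a b ≡ true → a ≡ v ⊎ b ≡ v
deleted-star v {a} {b} Fab with a ≟ v | b ≟ v
... | yes a≡v | _       = inj₁ a≡v
... | no _    | yes b≡v = inj₂ b≡v
deleted-star v () | no _ | no _

-- One-factorizations

-- Colour class k is encoded by the involution i ↦ match k i sending each
-- vertex to its partner in that perfect matching.
record OneFactorization (m : ℕ) {n} (G : Graph n) : Set where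
  field
    match              : Fin m → Fin n → Fin n
    match-involutive   : ∀ k i → match k (match k i) ≡ i
    match-fixpointFree : ∀ k i → match k i ≢ i
    match⊆G            : ∀ k i → G i (match k i) ≡ true
    G⊆match            : ∀ i j → G i j ≡ true → ∃[ k ] match k i ≡ j
    match-proper       : ∀ k l i → match k i ≡ match l i → k ≡ l

module _ {m n} {G : Graph n} (Φ : OneFactorization m G) where
  open OneFactorization Φ

  match⊆Gᵀ : ∀ k i → G (match k i) i ≡ true
  match⊆Gᵀ k i = subst (λ j → G (match k i) j ≡ true) (match-involutive k i) (match⊆G k (match k i))

  colourEdge : Fin m → Fin n → Fin n × Fin n
  colourEdge k i = orient i (match k i)

  colourEdge-injective : ∀ {k l i j} → colourEdge k i ≡ colourEdge l j → k ≡ l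
  colourEdge-injective {k} {l} {i} {j} e with orient-injective e
  ... | inj₁ (refl , mki≡mli) = match-proper k l i mki≡mli
  ... | inj₂ (refl , mki≡j)   = match-proper k l (match l j) (trans mki≡j (sym (match-involutive l j)))

  colourEdge-deleted : ∀ F k i → deleted F i (match k i) ≡ true → colourEdge k i ∈ deletedEdges G F
  colourEdge-deleted F k i =
    orient-selected G F (match-fixpointFree k i ∘ sym) (match⊆G k i) (match⊆Gᵀ k i)

  edge-colourEdge : ∀ {a b} → T (toℕ a <ᵇ toℕ b) → G a b ≡ true →
                    ∃[ k ] (a , b) ≡ colourEdge k a × (a , b) ≡ colourEdge k b
  edge-colourEdge {a} {b} a<b Gab with G⊆match a b Gab
  ... | k , refl = k , sym (proj₁ (orient-< a<b)) ,
                       trans (sym (proj₂ (orient-< a<b))) (cong (orient (match k a)) (sym (match-involutive k a)))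

  every-colour-deleted⇒m≤size : ∀ F → (∀ k → ∃[ i ] deleted F i (match k i) ≡ true) → m ≤ size G F
  every-colour-deleted⇒m≤size F hit =
    injection⇒≤length (deletedEdges G F) (λ k → colourEdge k (proj₁ (hit k))) colourEdge-injective
      (λ k → colourEdge-deleted F k (proj₁ (hit k)) (proj₂ (hit k)))

  colour-avoiding⇒fpm : ∀ F k → (∀ i → deleted F i (match k i) ≡ false) → FracPerfectMatching (G -E F)
  colour-avoiding⇒fpm F k avoids = involution⇒fpm (G -E F) (match k) (match-involutive k)
    λ i → cong₂ (λ x y → x ∧ not y) (match⊆G k i) (avoids i)

  size<m⇒fpm : ∀ F → size G F < m → FracPerfectMatching (G -E F)
  size<m⇒fpm F size<m with any? (λ k → all? λ i → deleted F i (match k i) Bool.≟ false)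
  ... | yes (k , avoids) = colour-avoiding⇒fpm F k avoids
  ... | no ¬avoids = ⊥-elim (ℕ.<⇒≱ size<m (every-colour-deleted⇒m≤size F hit))
    where
    hit : ∀ k → ∃[ i ] deleted F i (match k i) ≡ true
    hit k with ¬∀⟶∃¬ n _ (λ i → deleted F i (match k i) Bool.≟ false) (λ avoids → ¬avoids (k , avoids))
    ... | i , ¬avoids-i = i , ¬-not ¬avoids-i

  size-star : ∀ v → size G (star v) ≡ m
  size-star v = ℕ.≤-antisym
    (covered⇒length≤ L (deletedEdges-unique G (star v)) (λ k → colourEdge k v) (λ i → incident (∈-lookup {xs = L} i)))
    (every-colour-deleted⇒m≤size (star v) λ k → v , cong (_∨ (match k v == v)) (==-refl v))
    where
    L : List (Fin n × Fin n)
    L = deletedEdges G (star v)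

    incident : ∀ {p} → p ∈ L → ∃[ k ] p ≡ colourEdge k v
    incident {a , b} ab∈L with ∈-deletedEdges⁻ G (star v) ab∈L
    ... | a<b , Gab , Fab with edge-colourEdge a<b Gab | deleted-star v {a} {b} Fab
    ... | k , ab≡ka , _  | inj₁ refl = k , ab≡ka
    ... | k , _ , ab≡kb  | inj₂ refl = k , ab≡kb

  one-factorization⇒fmp≡ : Fin n → FmpEq G m
  one-factorization⇒fmp≡ v =
    (star v , size-star v , isolated⇒¬fpm (G -E star v) v (star-isolates G v)) , size<m⇒fpm

-- One-factorizations of restricted hypercube-like graphs

G84-match : Fin 3 → Fin 8 → Fin 8
G84-match k i = Vec.lookup (Vec.lookup partners k) i
  where
  partners : Vec (Vec (Fin 8) 8) 3
  partners = (# 1 ∷ # 0 ∷ # 3 ∷ # 2 ∷ # 5 ∷ # 4 ∷ # 7 ∷ # 6 ∷ [])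
           ∷ (# 7 ∷ # 2 ∷ # 1 ∷ # 4 ∷ # 3 ∷ # 6 ∷ # 5 ∷ # 0 ∷ [])
           ∷ (# 4 ∷ # 5 ∷ # 6 ∷ # 7 ∷ # 0 ∷ # 1 ∷ # 2 ∷ # 3 ∷ [])
           ∷ []

G84-factorization : OneFactorization 3 G84
G84-factorization = record
  { match              = G84-match
  ; match-involutive   = from-yes (all? λ k → all? λ i → G84-match k (G84-match k i) ≟ i)
  ; match-fixpointFree = from-yes (all? λ k → all? λ i → ¬? (G84-match k i ≟ i))
  ; match⊆G            = from-yes (all? λ k → all? λ i → G84 i (G84-match k i) Bool.≟ true)
  ; G⊆match            = from-yes (all? λ i → all? λ j → G84 i j Bool.≟ true →-dec any? λ k → G84-match k i ≟ j)
  ; match-proper       = from-yes (all? λ k → all? λ l → all? λ i → G84-match k i ≟ G84-match l i →-dec k ≟ l)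
  }

module ⊕-Factorization {m n} {G₀ G₁ : Graph n} (φ : Fin n ↔ Fin n)
                       (Φ₀ : OneFactorization m G₀) (Φ₁ : OneFactorization m G₁) where
  private
    module Φ₀ = OneFactorization Φ₀
    module Φ₁ = OneFactorization Φ₁
    open Inverse φ using (to; from; strictlyInverseˡ; strictlyInverseʳ)

    G : Graph (n ℕ.+ n)
    G = G₀ ⊕[ φ ] G₁

    data Side : Fin (n ℕ.+ n) → Set where
      left  : ∀ i → Side (i ↑ˡ n)
      right : ∀ j → Side (n ↑ʳ j)

    side : ∀ u → Side u
    side u = subst Side (join-splitAt n n u) (fromSplit (splitAt n u))
      where
      fromSplit : ∀ s → Side (join n n s)
      fromSplit (inj₁ i) = left i
      fromSplit (inj₂ j) = right j

    ↑ˡ≢↑ʳ : ∀ (i j : Fin n) → i ↑ˡ n ≢ n ↑ʳ j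
    ↑ˡ≢↑ʳ i j e with trans (sym (splitAt-↑ˡ n i n)) (trans (cong (splitAt n) e) (splitAt-↑ʳ n n j))
    ... | ()

    G-left-left : ∀ i j → G (i ↑ˡ n) (j ↑ˡ n) ≡ G₀ i j
    G-left-left i j rewrite splitAt-↑ˡ n i n | splitAt-↑ˡ n j n = refl

    G-left-right : ∀ i j → G (i ↑ˡ n) (n ↑ʳ j) ≡ (to i == j)
    G-left-right i j rewrite splitAt-↑ˡ n i n | splitAt-↑ʳ n n j = refl

    G-right-left : ∀ i j → G (n ↑ʳ j) (i ↑ˡ n) ≡ (to i == j)
    G-right-left i j rewrite splitAt-↑ˡ n i n | splitAt-↑ʳ n n j = refl

    G-right-right : ∀ i j → G (n ↑ʳ i) (n ↑ʳ j) ≡ G₁ i j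
    G-right-right i j rewrite splitAt-↑ʳ n n i | splitAt-↑ʳ n n j = refl

    matchSplit : Fin (suc m) → Fin n ⊎ Fin n → Fin (n ℕ.+ n)
    matchSplit zero    (inj₁ i) = n ↑ʳ to i
    matchSplit zero    (inj₂ j) = from j ↑ˡ n
    matchSplit (suc k) (inj₁ i) = Φ₀.match k i ↑ˡ n
    matchSplit (suc k) (inj₂ j) = n ↑ʳ Φ₁.match k j

    match : Fin (suc m) → Fin (n ℕ.+ n) → Fin (n ℕ.+ n)
    match k u = matchSplit k (splitAt n u)

    match-left : ∀ k i → match k (i ↑ˡ n) ≡ matchSplit k (inj₁ i)
    match-left k i = cong (matchSplit k) (splitAt-↑ˡ n i n)

    match-right : ∀ k j → match k (n ↑ʳ j) ≡ matchSplit k (inj₂ j)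
    match-right k j = cong (matchSplit k) (splitAt-↑ʳ n n j)

    match-involutive : ∀ k u → match k (match k u) ≡ u
    match-involutive k u with side u
    match-involutive zero    _ | left i  rewrite match-left zero i | match-right zero (to i) | strictlyInverseʳ i = refl
    match-involutive zero    _ | right j rewrite match-right zero j | match-left zero (from j) | strictlyInverseˡ j = refl
    match-involutive (suc k) _ | left i  rewrite match-left (suc k) i | match-left (suc k) (Φ₀.match k i) | Φ₀.match-involutive k i = refl
    match-involutive (suc k) _ | right j rewrite match-right (suc k) j | match-right (suc k) (Φ₁.match k j) | Φ₁.match-involutive k j = refl

    match-fixpointFree : ∀ k u → match k u ≢ u
    match-fixpointFree k u with side u
    match-fixpointFree zero    _ | left i  rewrite match-left zero i = ↑ˡ≢↑ʳ i (to i) ∘ sym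
    match-fixpointFree zero    _ | right j rewrite match-right zero j = ↑ˡ≢↑ʳ (from j) j
    match-fixpointFree (suc k) _ | left i  rewrite match-left (suc k) i = Φ₀.match-fixpointFree k i ∘ ↑ˡ-injective n _ _
    match-fixpointFree (suc k) _ | right j rewrite match-right (suc k) j = Φ₁.match-fixpointFree k j ∘ ↑ʳ-injective n _ _

    match⊆G : ∀ k u → G u (match k u) ≡ true
    match⊆G k u with side u
    match⊆G zero    _ | left i  rewrite match-left zero i | G-left-right i (to i) = ==-refl (to i)
    match⊆G zero    _ | right j rewrite match-right zero j | G-right-left (from j) j | strictlyInverseˡ j = ==-refl j
    match⊆G (suc k) _ | left i  rewrite match-left (suc k) i | G-left-left i (Φ₀.match k i) = Φ₀.match⊆G k i
    match⊆G (suc k) _ | right j rewrite match-right (suc k) j | G-right-right j (Φ₁.match k j) = Φ₁.match⊆G k j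

    G⊆match : ∀ u v → G u v ≡ true → ∃[ k ] match k u ≡ v
    G⊆match u v Guv with side u | side v
    ... | left i | left j with Φ₀.G⊆match i j (trans (sym (G-left-left i j)) Guv)
    ... | k , e = suc k , trans (match-left (suc k) i) (cong (_↑ˡ n) e)
    G⊆match u v Guv | left i | right j =
      zero , trans (match-left zero i) (cong (n ↑ʳ_) (==⇒≡ (trans (sym (G-left-right i j)) Guv)))
    G⊆match u v Guv | right j | left i =
      zero , trans (match-right zero j)
                   (cong (_↑ˡ n) (trans (cong from (sym (==⇒≡ (trans (sym (G-right-left i j)) Guv)))) (strictlyInverseʳ i)))
    G⊆match u v Guv | right i | right j with Φ₁.G⊆match i j (trans (sym (G-right-right i j)) Guv)
    ... | k , e = suc k , trans (match-right (suc k) i) (cong (n ↑ʳ_) e)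

    match-proper : ∀ k l u → match k u ≡ match l u → k ≡ l
    match-proper k l u e with side u
    match-proper zero    zero    _ e | _ = refl
    match-proper zero    (suc l) _ e | left i  rewrite match-left zero i | match-left (suc l) i = ⊥-elim (↑ˡ≢↑ʳ _ _ (sym e))
    match-proper zero    (suc l) _ e | right j rewrite match-right zero j | match-right (suc l) j = ⊥-elim (↑ˡ≢↑ʳ _ _ e)
    match-proper (suc k) zero    _ e | left i  rewrite match-left zero i | match-left (suc k) i = ⊥-elim (↑ˡ≢↑ʳ _ _ e)
    match-proper (suc k) zero    _ e | right j rewrite match-right zero j | match-right (suc k) j = ⊥-elim (↑ˡ≢↑ʳ _ _ (sym e))
    match-proper (suc k) (suc l) _ e | left i  rewrite match-left (suc k) i | match-left (suc l) i =
      cong suc (Φ₀.match-proper k l i (↑ˡ-injective n _ _ e))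
    match-proper (suc k) (suc l) _ e | right j rewrite match-right (suc k) j | match-right (suc l) j =
      cong suc (Φ₁.match-proper k l j (↑ʳ-injective n _ _ e))

  factorization : OneFactorization (suc m) (G₀ ⊕[ φ ] G₁)
  factorization = record
    { match              = match
    ; match-involutive   = match-involutive
    ; match-fixpointFree = match-fixpointFree
    ; match⊆G            = match⊆G
    ; G⊆match            = G⊆match
    ; match-proper       = match-proper
    }

≅-factorization : ∀ {m n} {G H : Graph n} → OneFactorization m G → G ≅ H → OneFactorization m H
≅-factorization {G = G} {H} Φ (σ , σ-preserves) = record
  { match              = λ k x → to (match k (from x))
  ; match-involutive   = λ k x → trans (cong (to ∘ match k) (strictlyInverseʳ _))
                                       (trans (cong to (match-involutive k _)) (strictlyInverseˡ x))
  ; match-fixpointFree = λ k x e → match-fixpointFree k (from x)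
                                     (trans (sym (strictlyInverseʳ _)) (cong from e))
  ; match⊆G            = λ k x → trans (H≡G∘from x _) (trans (cong (G (from x)) (strictlyInverseʳ _)) (match⊆G k _))
  ; G⊆match            = λ x y Hxy → let (k , e) = G⊆match _ _ (trans (sym (H≡G∘from x y)) Hxy)
                                     in k , trans (cong to e) (strictlyInverseˡ y)
  ; match-proper       = λ k l x e → match-proper k l (from x)
                                       (trans (sym (strictlyInverseʳ _)) (trans (cong from e) (strictlyInverseʳ _)))
  }
  where
  open OneFactorization Φ
  open Inverse σ using (to; from; strictlyInverseˡ; strictlyInverseʳ)

  H≡G∘from : ∀ x y → H x y ≡ G (from x) (from y)
  H≡G∘from x y = trans (cong₂ H (sym (strictlyInverseˡ x)) (sym (strictlyInverseˡ y))) (σ-preserves (from x) (from y))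

rhl-factorization : ∀ {m n} {G : Graph n} → RHL m G → OneFactorization m G
rhl-factorization base           = G84-factorization
rhl-factorization (step R₀ R₁ φ) = ⊕-Factorization.factorization φ (rhl-factorization R₀) (rhl-factorization R₁)
rhl-factorization (iso R G≅H)    = ≅-factorization (rhl-factorization R) G≅H

rhl-vertex : ∀ {m n} {G : Graph n} → RHL m G → Fin n
rhl-vertex base          = zero
rhl-vertex (step R₀ _ _) = rhl-vertex R₀ ↑ˡ _
rhl-vertex (iso R _)     = rhl-vertex R

-- The argument works for every m.
mainTheorem1 : ∀ (m : ℕ) → 3 ≤ m → ∀ {n} (G : Graph n) → RHL m G → FmpEq G m
mainTheorem1 m _ G R = one-factorization⇒fmp≡ (rhl-factorization R) (rhl-vertex R)
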